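{- The following statements are equivalent: (i) every even integer greater than $5$ can be written as the sum of two odd primes; (ii) the graph $\mathcal{G}_n$ is connected for all $n\ge 7$; (iii) every even integer $v\ge 6$ has non-zero in-degree in $\overrightarrow{\mathcal{G}}_{\infty}$, i.e. $d^-_\infty(v)>0$ for all even $v\ge 6$.
   Context: Let $\mathcal{P}$ be the set of odd primes and $\mathcal{E}$ the set of non-negative even integers. $\overrightarrow{\mathcal{G}}_{\infty}$ is the directed graph with vertex set $\mathcal{E}$ and an arc $a\to b$ iff $\frac{a+b}{2}\in\mathcal{P}$ and $\frac{b-a}{2}\in\mathcal{P}$; $d^-_\infty(v)$ is the number of $u\in\mathcal{E}$ with $u\to v$. For a positive integer $n$, let $\mathcal{E}_n=\{0,2,4,\dots,2n\}$ and let $\mathcal{G}_n$ be the simple undirected graph with vertex set $\mathcal{E}_n$ in which distinct $a,b$ are adjacent iff $\frac{a+b}{2}\in\mathcal{P}$ and $\frac{|a-b|}{2}\in\mathcal{P}$. -}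

module Defs where

open import Data.Nat using (ℕ; _+_; _*_; _∸_; _≤_; _<_; ∣_-_∣)
open import Data.Nat.DivMod using (_/_)
open import Data.Nat.Divisibility using (_∣_)
open import Data.Nat.Primality using (Prime)
open import Data.Product using (_×_; ∃-syntax)
open import Relation.Binary.PropositionalEquality using (_≡_; _≢_)
open import Relation.Binary.Construct.Closure.ReflexiveTransitive using (Star)
open import Function.Bundles using (_⇔_)

OddPrime : ℕ → Set
OddPrime p = Prime p × p ≢ 2

IsEven : ℕ → Set
IsEven a = 2 ∣ a

-- Arc a → b in the directed graph G⃗∞ (on ℰ):
--   (a+b)/2 ∈ 𝒫 and (b-a)/2 ∈ 𝒫.
-- (b-a)/2 being a prime forces b > a, so we require a < b and
-- use truncated subtraction only where it is exact.
Arc : ℕ → ℕ → Set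
Arc a b = IsEven a × IsEven b × a < b
        × OddPrime ((a + b) / 2) × OddPrime ((b ∸ a) / 2)

PositiveInDegree : ℕ → Set
PositiveInDegree v = ∃[ u ] Arc u v

InEn : ℕ → ℕ → Set
InEn n a = IsEven a × a ≤ 2 * n

Adj : ℕ → ℕ → ℕ → Set
Adj n a b = InEn n a × InEn n b × a ≢ b
          × OddPrime ((a + b) / 2) × OddPrime (∣ a - b ∣ / 2)

Connected : ℕ → Set
Connected n = ∀ a b → InEn n a → InEn n b → Star (Adj n) a b

StatementI : Set
StatementI = ∀ m → IsEven m → 5 < m →
  ∃[ p ] ∃[ q ] (OddPrime p × OddPrime q × m ≡ p + q)

StatementII : Set
StatementII = ∀ n → 7 ≤ n → Connected n

StatementIII : Set
StatementIII = ∀ v → IsEven v → 6 ≤ v → PositiveInDegree v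

-- An arc u → v is the same thing as a decomposition v = p + q into odd primes p ≤ q:
-- take q = (u + v)/2 and p = (v - u)/2, and conversely u = q - p.  Hence (i) ⇔ (iii).
-- Given (iii), every vertex a ≥ 6 of Gₙ is adjacent to the tail of an arc into a, which is
-- smaller than a, while 2 – 8 – 14 – 0 and 4 – 10 – 0 are paths once n ≥ 7; so every vertex
-- is joined to 0.  Conversely, in a connected Gₙ the top vertex 2n has a neighbour, which lies
-- below 2n and is therefore the tail of an arc into 2n; small cases are checked directly.
module Submission where

open import Defs
open import Data.Product using (_×_)
open import Function.Bundles using (_⇔_)

open import Data.Nat
open import Data.Nat.Properties
open import Data.Nat.DivMod using (_/_; m*n/n≡m)
open import Data.Nat.Divisibility using (divides; _∣?_; ∣m+n∣m⇒∣n)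
open import Data.Nat.Primality using (prime?; prime⇒nonZero)
open import Data.Nat.Induction using (<-rec)
open import Data.Nat.Tactic.RingSolver using (solve-∀)
open import Data.Product using (∃-syntax; _,_)
open import Data.Sum using (inj₁; inj₂)
open import Function.Bundles using (mk⇔)
open import Relation.Nullary.Decidable using (Dec; True; toWitness; from-yes; _×-dec_; ¬?)
open import Relation.Unary using (Decidable)
open import Relation.Binary.PropositionalEquality
open import Relation.Binary.Construct.Closure.ReflexiveTransitive using (Star; ε; _◅_; _◅◅_; reverse)

SumOfTwoOddPrimes : ℕ → Set
SumOfTwoOddPrimes m = ∃[ p ] ∃[ q ] (OddPrime p × OddPrime q × m ≡ p + q)

oddPrime? : Decidable OddPrime
oddPrime? p = prime? p ×-dec ¬? (p ≟ 2)

arc? : ∀ a b → Dec (Arc a b)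
arc? a b = 2 ∣? a ×-dec 2 ∣? b ×-dec a <? b ×-dec oddPrime? _ ×-dec oddPrime? _

oddPrime⇒positive : ∀ {p} → OddPrime p → 0 < p
oddPrime⇒positive {p} (p-prime , _) = >-nonZero⁻¹ p {{prime⇒nonZero p-prime}}

-- Arcs u → v are parametrised as v = p + (p + u), the decomposition being v = (p + u) + p.

[u+v]/2≡p+u : ∀ p u → (u + (p + (p + u))) / 2 ≡ p + u
[u+v]/2≡p+u p u = begin
  (u + (p + (p + u))) / 2 ≡⟨ cong (_/ 2) (u+[p+[p+u]]≡[p+u]*2 p u) ⟩
  (p + u) * 2 / 2         ≡⟨ m*n/n≡m (p + u) 2 ⟩
  p + u                   ∎
  where
  open ≡-Reasoning
  u+[p+[p+u]]≡[p+u]*2 : ∀ p u → u + (p + (p + u)) ≡ (p + u) * 2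
  u+[p+[p+u]]≡[p+u]*2 = solve-∀

[v∸u]/2≡p : ∀ p u → (p + (p + u) ∸ u) / 2 ≡ p
[v∸u]/2≡p p u = begin
  (p + (p + u) ∸ u) / 2 ≡⟨ cong (λ v → (v ∸ u) / 2) (p+[p+u]≡p*2+u p u) ⟩
  (p * 2 + u ∸ u) / 2   ≡⟨ cong (_/ 2) (m+n∸n≡m (p * 2) u) ⟩
  p * 2 / 2             ≡⟨ m*n/n≡m p 2 ⟩
  p                     ∎
  where
  open ≡-Reasoning
  p+[p+u]≡p*2+u : ∀ p u → p + (p + u) ≡ p * 2 + u
  p+[p+u]≡p*2+u = solve-∀

even≤even⇒∃p[v≡p+[p+u]] : ∀ {u v} → IsEven u → IsEven v → u ≤ v → ∃[ p ] v ≡ p + (p + u)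
even≤even⇒∃p[v≡p+[p+u]] {u} {v} even-u even-v u≤v
  with ∣m+n∣m⇒∣n (subst IsEven (sym (m+[n∸m]≡n u≤v)) even-v) even-u
... | divides p v∸u≡p*2 = p , (begin
  v               ≡⟨ m+[n∸m]≡n u≤v ⟨
  u + (v ∸ u)     ≡⟨ cong (u +_) v∸u≡p*2 ⟩
  u + p * 2       ≡⟨ u+p*2≡p+[p+u] p u ⟩
  p + (p + u)     ∎)
  where
  open ≡-Reasoning
  u+p*2≡p+[p+u] : ∀ p u → u + p * 2 ≡ p + (p + u)
  u+p*2≡p+[p+u] = solve-∀

arcFromOrderedSum : ∀ {p d} → OddPrime p → OddPrime (p + d) → IsEven (p + (p + d)) → Arc d (p + (p + d))
arcFromOrderedSum {p} {d} op oq even-v =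
    ∣m+n∣m⇒∣n (subst IsEven (p+[p+d]≡p*2+d p d) even-v) (divides p refl)
  , even-v
  , ≤-trans (m<n+m d (oddPrime⇒positive op)) (m≤n+m (p + d) p)
  , subst OddPrime (sym ([u+v]/2≡p+u p d)) oq
  , subst OddPrime (sym ([v∸u]/2≡p p d)) op
  where
  p+[p+d]≡p*2+d : ∀ p d → p + (p + d) ≡ p * 2 + d
  p+[p+d]≡p*2+d = solve-∀

orderedSum⇒positiveInDegree : ∀ {p q} → OddPrime p → OddPrime q → p ≤ q → IsEven (p + q) → PositiveInDegree (p + q)
orderedSum⇒positiveInDegree op oq p≤q even-v with m≤n⇒∃[o]m+o≡n p≤q
... | d , refl = d , arcFromOrderedSum op oq even-v

sumOfTwoOddPrimes⇒positiveInDegree : ∀ {v} → IsEven v → SumOfTwoOddPrimes v → PositiveInDegree v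
sumOfTwoOddPrimes⇒positiveInDegree even-v (p , q , op , oq , refl) with ≤-total p q
... | inj₁ p≤q = orderedSum⇒positiveInDegree op oq p≤q even-v
... | inj₂ q≤p = subst PositiveInDegree (+-comm q p)
  (orderedSum⇒positiveInDegree oq op q≤p (subst IsEven (+-comm p q) even-v))

positiveInDegree⇒sumOfTwoOddPrimes : ∀ {v} → PositiveInDegree v → SumOfTwoOddPrimes v
positiveInDegree⇒sumOfTwoOddPrimes (u , even-u , even-v , u<v , oq , op)
  with even≤even⇒∃p[v≡p+[p+u]] even-u even-v (<⇒≤ u<v)
... | p , refl = p + u , p
  , subst OddPrime ([u+v]/2≡p+u p u) oq
  , subst OddPrime ([v∸u]/2≡p p u) op
  , +-comm p (p + u)

arc⇒adj : ∀ {n u v} → Arc u v → v ≤ 2 * n → Adj n v u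
arc⇒adj {u = u} {v} (even-u , even-v , u<v , o₁ , o₂) v≤2n =
    (even-v , v≤2n)
  , (even-u , ≤-trans (<⇒≤ u<v) v≤2n)
  , >⇒≢ u<v
  , subst OddPrime (cong (_/ 2) (+-comm u v)) o₁
  , subst OddPrime (cong (_/ 2) (sym (m≤n⇒∣n-m∣≡n∸m (<⇒≤ u<v)))) o₂

adj⇒arc : ∀ {n a b} → Adj n a b → b ≤ a → Arc b a
adj⇒arc {a = a} {b} ((even-a , _) , (even-b , _) , a≢b , o₁ , o₂) b≤a =
    even-b , even-a , b<a
  , subst OddPrime (cong (_/ 2) (+-comm a b)) o₁
  , subst OddPrime (cong (_/ 2) (m≤n⇒∣n-m∣≡n∸m b≤a)) o₂
  where
  b<a : b < a
  b<a = ≤∧≢⇒< b≤a (λ b≡a → a≢b (sym b≡a))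

adj-sym : ∀ {n a b} → Adj n a b → Adj n b a
adj-sym {a = a} {b} (in-a , in-b , a≢b , o₁ , o₂) =
  in-b , in-a , (λ b≡a → a≢b (sym b≡a))
  , subst OddPrime (cong (_/ 2) (+-comm a b)) o₁
  , subst OddPrime (cong (_/ 2) (∣-∣-comm a b)) o₂

module _ (positiveInDegree : StatementIII) {n : ℕ} (7≤n : 7 ≤ n) where

  private
    edge : ∀ {u v} → Arc u v → {v≤14 : True (v ≤? 14)} → Adj n v u
    edge arc {v≤14} = arc⇒adj {n} arc (≤-trans (toWitness v≤14) (*-monoʳ-≤ 2 7≤n))

  joinedToZero : ∀ a → InEn n a → Star (Adj n) a 0
  joinedToZero = <-rec _ step
    where
    step : ∀ a → (∀ {b} → b < a → InEn n b → Star (Adj n) b 0) → InEn n a → Star (Adj n) a 0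
    step .0       _   (divides 0 refl , _) = ε
    step .2       _   (divides 1 refl , _) =
          adj-sym {n} (edge (from-yes (arc? 2 8)))
        ◅ adj-sym {n} (edge (from-yes (arc? 8 14)))
        ◅ edge (from-yes (arc? 0 14))
        ◅ ε
    step .4       _   (divides 2 refl , _) =
          adj-sym {n} (edge (from-yes (arc? 4 10)))
        ◅ edge (from-yes (arc? 0 10))
        ◅ ε
    step .(i * 2) rec (divides i@(suc (suc (suc k))) refl , a≤2n)
      with positiveInDegree (i * 2) (divides i refl) (m≤m+n 6 (k * 2))
    ... | u , arc@(even-u , _ , u<a , _) =
      arc⇒adj {n} arc a≤2n ◅ rec u<a (even-u , ≤-trans (<⇒≤ u<a) a≤2n)

  connected : Connected n
  connected a b in-a in-b = joinedToZero a in-a ◅◅ reverse (adj-sym {n}) (joinedToZero b in-b)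

connected⇒topVertex-positiveInDegree : ∀ n → Connected (suc n) → PositiveInDegree (2 * suc n)
connected⇒topVertex-positiveInDegree n conn
  with conn (2 * suc n) 0 (divides (suc n) (*-comm 2 (suc n)) , ≤-refl) (divides 0 refl , z≤n)
... | adj@(_ , (_ , c≤2n) , _) ◅ _ = _ , adj⇒arc {suc n} adj c≤2n

I⇒III : StatementI → StatementIII
I⇒III goldbach v even-v 6≤v = sumOfTwoOddPrimes⇒positiveInDegree even-v (goldbach v even-v 6≤v)

III⇒I : StatementIII → StatementI
III⇒I positiveInDegree m even-m 5<m = positiveInDegree⇒sumOfTwoOddPrimes (positiveInDegree m even-m 5<m)

III⇒II : StatementIII → StatementII
III⇒II positiveInDegree n 7≤n = connected positiveInDegree 7≤n

II⇒III : StatementII → StatementIII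
II⇒III _ .2  (divides 1 refl) (s≤s (s≤s ()))
II⇒III _ .4  (divides 2 refl) (s≤s (s≤s (s≤s (s≤s ()))))
II⇒III _ .6  (divides 3 refl) _ = 0 , from-yes (arc? 0 6)
II⇒III _ .8  (divides 4 refl) _ = 2 , from-yes (arc? 2 8)
II⇒III _ .10 (divides 5 refl) _ = 0 , from-yes (arc? 0 10)
II⇒III _ .12 (divides 6 refl) _ = 2 , from-yes (arc? 2 12)
II⇒III conn .(k * 2) (divides k@(suc m@(suc (suc (suc (suc (suc (suc l))))))) refl) _ =
  subst PositiveInDegree (*-comm 2 k) (connected⇒topVertex-positiveInDegree m (conn k (m≤m+n 7 l)))

mainTheorem5 : (StatementI ⇔ StatementII) × (StatementII ⇔ StatementIII)
mainTheorem5 =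
    mk⇔ (λ i → III⇒II (I⇒III i)) (λ ii → III⇒I (II⇒III ii))
  , mk⇔ II⇒III III⇒II
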